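{- For every finite simple graph $G$ with no isolated vertices, $\sum_{v\in V(G)} l(v)\le 0$.
   Context: For a vertex $v$ of positive degree in a finite simple graph, with neighborhood $N_v$, the leverage centrality is $l(v)=\frac{1}{\deg(v)}\sum_{w\in N_v}\frac{\deg(v)-\deg(w)}{\deg(v)+\deg(w)}$. -}

module Defs where

open import Data.Nat using (ℕ; zero; suc; _+_)
open import Data.Bool using (Bool; true; false; if_then_else_)
open import Data.Fin using (Fin; zero; suc)
open import Data.Integer using (ℤ; +_; _-_)
open import Data.Rational using (ℚ; _/_; 0ℚ; _≤_) renaming (_+_ to _+ℚ_; _*_ to _*ℚ_)
open import Relation.Binary.PropositionalEquality using (_≡_)
open import Relation.Nullary using (¬_)

record SimpleGraph (n : ℕ) : Set where
  field
    Adj     : Fin n → Fin n → Bool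
    symm    : ∀ u v → Adj u v ≡ Adj v u
    loopless : ∀ v → Adj v v ≡ false
open SimpleGraph public

sumℕ : (n : ℕ) → (Fin n → ℕ) → ℕ
sumℕ zero    f = 0
sumℕ (suc n) f = f zero + sumℕ n (λ i → f (suc i))

sumℚ : (n : ℕ) → (Fin n → ℚ) → ℚ
sumℚ zero    f = 0ℚ
sumℚ (suc n) f = f zero +ℚ sumℚ n (λ i → f (suc i))

deg : ∀ {n} → SimpleGraph n → Fin n → ℕ
deg {n} G v = sumℕ n (λ w → if Adj G v w then 1 else 0)

term : ℕ → ℕ → ℚ
term zero    dw = 0ℚ   -- never used for vertices of positive degree
term (suc k) dw = (+ suc k - + dw) / (suc k + dw)

-- leverage centrality l(v) = (1/deg v) Σ_{w ∈ N(v)} (deg v - deg w)/(deg v + deg w);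
-- defined as 0 for isolated vertices (a convention; the theorem excludes them)
leverage : ∀ {n} → SimpleGraph n → Fin n → ℚ
leverage {n} G v with deg G v
... | zero  = 0ℚ
... | suc k = (+ 1 / suc k) *ℚ
    sumℚ n (λ w → if Adj G v w then term (suc k) (deg G w) else 0ℚ)

NoIsolated : ∀ {n} → SimpleGraph n → Set
NoIsolated {n} G = ∀ (v : Fin n) → ¬ (deg G v ≡ 0)

-- Pair up the two occurrences of every edge vw in the double sum Σ_v l(v):
-- with a = deg v and b = deg w they contribute
--   (a - b)/(a(a + b)) + (b - a)/(b(a + b)) = -(a - b)²/(ab(a + b)) ≤ 0,
-- so twice the sum, and hence the sum itself, is non-positive.
module Submission where

open import Defs
open import Data.Nat as ℕ using (ℕ; zero; suc)
open import Data.Rational using (0ℚ; _≤_)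
open import Data.Bool using (true; false; if_then_else_)
open import Data.Fin using (Fin; zero; suc)
open import Data.Empty using (⊥-elim)
open import Data.Integer as ℤ using (+_; -[1+_]; +≤+; 0ℤ)
import Data.Integer.Properties as ℤP
open import Data.Integer.Solver using (module +-*-Solver)
open import Data.Rational as ℚ using (ℚ; toℚᵘ)
import Data.Rational.Properties as ℚP
open import Data.Rational.Unnormalised as ℚᵘ using (ℚᵘ; mkℚᵘ; *≤*)
import Data.Rational.Unnormalised.Properties as ℚᵘP
open import Data.Vec.Functional using (Vector; map)
open import Algebra.Bundles using (CommutativeRing)
open import Algebra.Properties.Semiring.Sum (CommutativeRing.semiring ℚP.+-*-commutativeRing)
open import Relation.Nullary using (¬_; yes; no)
open import Relation.Binary.PropositionalEquality

0≤i*i : ∀ i → 0ℤ ℤ.≤ i ℤ.* i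
0≤i*i (+ n) rewrite sym (ℤP.pos-* n n) = +≤+ ℕ.z≤n
0≤i*i -[1+ n ] = +≤+ ℕ.z≤n

pairNumerator≡ : ∀ a b → (a ℤ.- b) ℤ.* (b ℤ.* (b ℤ.+ a)) ℤ.+ (b ℤ.- a) ℤ.* (a ℤ.* (a ℤ.+ b))
                         ≡ ℤ.- ((a ℤ.- b) ℤ.* (a ℤ.- b) ℤ.* (a ℤ.+ b))
pairNumerator≡ = solve 2 (λ a b → (a :- b) :* (b :* (b :+ a)) :+ (b :- a) :* (a :* (a :+ b))
                                  := :- ((a :- b) :* (a :- b) :* (a :+ b))) refl
  where open +-*-Solver

pairNumerator≤0 : ∀ a b → (+ a ℤ.- + b) ℤ.* + (b ℕ.* (b ℕ.+ a)) ℤ.+ (+ b ℤ.- + a) ℤ.* + (a ℕ.* (a ℕ.+ b)) ℤ.≤ 0ℤ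
pairNumerator≤0 a b = begin
  (+ a ℤ.- + b) ℤ.* + (b ℕ.* (b ℕ.+ a)) ℤ.+ (+ b ℤ.- + a) ℤ.* + (a ℕ.* (a ℕ.+ b))
    ≡⟨ cong₂ (λ c d → (+ a ℤ.- + b) ℤ.* c ℤ.+ (+ b ℤ.- + a) ℤ.* d) (ℤP.pos-* b (b ℕ.+ a)) (ℤP.pos-* a (a ℕ.+ b)) ⟩
  (+ a ℤ.- + b) ℤ.* (+ b ℤ.* (+ b ℤ.+ + a)) ℤ.+ (+ b ℤ.- + a) ℤ.* (+ a ℤ.* (+ a ℤ.+ + b))
    ≡⟨ pairNumerator≡ (+ a) (+ b) ⟩
  ℤ.- ((+ a ℤ.- + b) ℤ.* (+ a ℤ.- + b) ℤ.* (+ a ℤ.+ + b))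
    ≤⟨ ℤP.neg-mono-≤ (ℤP.*-monoʳ-≤-nonNeg (+ a ℤ.+ + b) (0≤i*i (+ a ℤ.- + b))) ⟩
  0ℤ ∎
  where open ℤP.≤-Reasoning

share : ℕ → ℕ → ℚ
share zero    _ = 0ℚ
share (suc k) b = (+ 1 ℚ./ suc k) ℚ.* term (suc k) b

shareᵘ : ℕ → ℕ → ℚᵘ
shareᵘ a b = (+ 1 ℚᵘ./ suc a) ℚᵘ.* ((+ suc a ℤ.- + suc b) ℚᵘ./ (suc a ℕ.+ suc b))

shareᵘ-pair≤0 : ∀ a b → shareᵘ a b ℚᵘ.+ shareᵘ b a ℚᵘ.≤ ℚᵘ.0ℚᵘ
shareᵘ-pair≤0 a b = *≤* (begin
  ((+ 1 ℤ.* (A ℤ.- B)) ℤ.* D ℤ.+ (+ 1 ℤ.* (B ℤ.- A)) ℤ.* C) ℤ.* + 1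
    ≡⟨ ℤP.*-identityʳ _ ⟩
  (+ 1 ℤ.* (A ℤ.- B)) ℤ.* D ℤ.+ (+ 1 ℤ.* (B ℤ.- A)) ℤ.* C
    ≡⟨ cong₂ (λ x y → x ℤ.* D ℤ.+ y ℤ.* C) (ℤP.*-identityˡ (A ℤ.- B)) (ℤP.*-identityˡ (B ℤ.- A)) ⟩
  (A ℤ.- B) ℤ.* D ℤ.+ (B ℤ.- A) ℤ.* C
    ≤⟨ pairNumerator≤0 (suc a) (suc b) ⟩
  0ℤ ∎)
  where
  open ℤP.≤-Reasoning
  A = + suc a
  B = + suc b
  C = + (suc a ℕ.* (suc a ℕ.+ suc b))
  D = + (suc b ℕ.* (suc b ℕ.+ suc a))

toℚᵘ-share : ∀ a b → toℚᵘ (share (suc a) (suc b)) ℚᵘ.≃ shareᵘ a b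
-- By definition i ℚ./ suc d is fromℚᵘ (mkℚᵘ i d).
toℚᵘ-share a b = ℚᵘP.≃-trans (ℚP.toℚᵘ-homo-* (+ 1 ℚ./ suc a) (term (suc a) (suc b)))
  (ℚᵘP.*-cong (ℚP.toℚᵘ-fromℚᵘ (mkℚᵘ (+ 1) a)) (ℚP.toℚᵘ-fromℚᵘ (mkℚᵘ (+ suc a ℤ.- + suc b) (a ℕ.+ suc b))))

share-pair≤0 : ∀ a b → share (suc a) (suc b) ℚ.+ share (suc b) (suc a) ≤ 0ℚ
share-pair≤0 a b = ℚP.toℚᵘ-cancel-≤ (ℚᵘP.≤-respˡ-≃ (ℚᵘP.≃-sym toℚᵘ-pair) (shareᵘ-pair≤0 a b))
  where
  toℚᵘ-pair : toℚᵘ (share (suc a) (suc b) ℚ.+ share (suc b) (suc a)) ℚᵘ.≃ shareᵘ a b ℚᵘ.+ shareᵘ b a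
  toℚᵘ-pair = ℚᵘP.≃-trans (ℚP.toℚᵘ-homo-+ (share (suc a) (suc b)) (share (suc b) (suc a)))
                          (ℚᵘP.+-cong (toℚᵘ-share a b) (toℚᵘ-share b a))

sumℚ≡sum : ∀ n (f : Vector ℚ n) → sumℚ n f ≡ sum f
sumℚ≡sum zero    f = refl
sumℚ≡sum (suc n) f = cong (f zero ℚ.+_) (sumℚ≡sum n (λ i → f (suc i)))

sum≤0 : ∀ {n} (f : Vector ℚ n) → (∀ i → f i ≤ 0ℚ) → sum f ≤ 0ℚ
sum≤0 {zero}  f f≤0 = ℚP.≤-refl
sum≤0 {suc n} f f≤0 = ℚP.+-mono-≤ (f≤0 zero) (sum≤0 (λ i → f (suc i)) (λ i → f≤0 (suc i)))

p+p≤0⇒p≤0 : ∀ p → p ℚ.+ p ≤ 0ℚ → p ≤ 0ℚ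
p+p≤0⇒p≤0 p p+p≤0 with p ℚP.≤? 0ℚ
... | yes p≤0 = p≤0
... | no  p≰0 = ⊥-elim (ℚP.<-irrefl refl (ℚP.<-≤-trans (ℚP.+-mono-< 0<p 0<p) p+p≤0))
  where 0<p = ℚP.≰⇒> p≰0

double-sum≤0 : ∀ {n} (f : Fin n → Fin n → ℚ) → (∀ v w → f v w ℚ.+ f w v ≤ 0ℚ) →
               ∑[ v < n ] ∑[ w < n ] f v w ≤ 0ℚ
double-sum≤0 {n} f pair≤0 = p+p≤0⇒p≤0 S (subst (_≤ 0ℚ) (sym S+S≡) (sum≤0 _ (λ v → sum≤0 _ (pair≤0 v))))
  where
  open ≡-Reasoning
  S = ∑[ v < n ] ∑[ w < n ] f v w
  S+S≡ : S ℚ.+ S ≡ ∑[ v < n ] ∑[ w < n ] (f v w ℚ.+ f w v)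
  S+S≡ = begin
    S ℚ.+ S                                                  ≡⟨ cong (S ℚ.+_) (∑-comm f) ⟩
    S ℚ.+ ∑[ v < n ] ∑[ w < n ] f w v                        ≡⟨ sym (∑-distrib-+ (λ v → sum (f v)) _) ⟩
    ∑[ v < n ] (∑[ w < n ] f v w ℚ.+ ∑[ w < n ] f w v)       ≡⟨ sum-cong-≗ (λ v → sym (∑-distrib-+ (f v) (λ w → f w v))) ⟩
    ∑[ v < n ] ∑[ w < n ] (f v w ℚ.+ f w v)                  ∎

edgeShare : ∀ {n} → SimpleGraph n → Fin n → Fin n → ℚ
edgeShare G v w = if Adj G v w then share (deg G v) (deg G w) else 0ℚ

leverage≡∑edgeShare : ∀ {n} (G : SimpleGraph n) v → ¬ deg G v ≡ 0 → leverage G v ≡ sum (edgeShare G v)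
leverage≡∑edgeShare {n} G v deg≢0 with deg G v
... | zero  = ⊥-elim (deg≢0 refl)
... | suc k = begin
  (+ 1 ℚ./ suc k) ℚ.* sumℚ n t                  ≡⟨ cong ((+ 1 ℚ./ suc k) ℚ.*_) (sumℚ≡sum n t) ⟩
  (+ 1 ℚ./ suc k) ℚ.* sum t                      ≡⟨ *-distribˡ-sum (+ 1 ℚ./ suc k) t ⟩
  sum (map ((+ 1 ℚ./ suc k) ℚ.*_) t)             ≡⟨ sum-cong-≗ scale ⟩
  -- the with-abstraction has also replaced deg G v inside edgeShare G v
  sum (λ w → if Adj G v w then share (suc k) (deg G w) else 0ℚ) ∎
  where
  open ≡-Reasoning
  t : Vector ℚ n
  t w = if Adj G v w then term (suc k) (deg G w) else 0ℚ
  scale : ∀ w → (+ 1 ℚ./ suc k) ℚ.* t w ≡ (if Adj G v w then share (suc k) (deg G w) else 0ℚ)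
  scale w with Adj G v w
  ... | true  = refl
  ... | false = ℚP.*-zeroʳ (+ 1 ℚ./ suc k)

edgeShare-pair≤0 : ∀ {n} (G : SimpleGraph n) → NoIsolated G →
                   ∀ v w → edgeShare G v w ℚ.+ edgeShare G w v ≤ 0ℚ
edgeShare-pair≤0 G noIsolated v w rewrite symm G w v with Adj G v w
... | false = ℚP.≤-refl
... | true with deg G v in deg-v | deg G w in deg-w
...   | zero  | _     = ⊥-elim (noIsolated v deg-v)
...   | suc _ | zero  = ⊥-elim (noIsolated w deg-w)
...   | suc a | suc b = share-pair≤0 a b

mainTheorem1 : (n : ℕ) (G : SimpleGraph n) → NoIsolated G →
    sumℚ n (leverage G) ≤ 0ℚ
mainTheorem1 n G noIsolated =
  subst (_≤ 0ℚ) (sym ∑leverage≡) (double-sum≤0 (edgeShare G) (edgeShare-pair≤0 G noIsolated))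
  where
  ∑leverage≡ : sumℚ n (leverage G) ≡ ∑[ v < n ] ∑[ w < n ] edgeShare G v w
  ∑leverage≡ = trans (sumℚ≡sum n (leverage G))
                     (sum-cong-≗ (λ v → leverage≡∑edgeShare G v (noIsolated v)))
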